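{- Let $n\ge2$ be an integer and $r$ an integer with $1\le r<n$ and $\gcd(r,n)=1$. Then $r/n$ and $(n-r)/n$ generate the same orbit of partitions of $n$.
   Context: Let $\Phi_0=\begin{pmatrix}0&1\\1&1\end{pmatrix}$, $\Phi_1=\begin{pmatrix}1&0\\1&1\end{pmatrix}$. The Farey map is $F(x)=(1-x)/x$ on $[1/2,1]$, $F(x)=x/(1-x)$ on $[0,1/2]$. For a rational $x\in(0,1)$ let $\ell\ge0$ be least with $F^\ell(x)=1/2$; its binary sequence is $\sigma_1\cdots\sigma_\ell$ with $\sigma_j=0$ if $F^{j-1}(x)\in(1/2,1)$ and $\sigma_j=1$ if $F^{j-1}(x)\in(0,1/2)$; if $x=p/q$ in lowest terms then $(p,q)^T=\Phi_{\sigma_1}\cdots\Phi_{\sigma_\ell}(1,2)^T$. The orbit of partitions generated by $r/n$ (with binary sequence $\sigma_1\cdots\sigma_\ell$) is the sequence, for $m=1,\dots,\ell$, of the partitions $(n_1^{k_1},n_2^{k_2})$ of $n$ ($k_1$ parts $n_1$, $k_2$ parts $n_2$), where $\Phi_{\sigma_1}\cdots\Phi_{\sigma_m}=\begin{pmatrix}h_2&h_1\\k_2&k_1\end{pmatrix}$ and $(n_2,n_1)^T=\Phi_{\sigma_{m+1}}\cdots\Phi_{\sigma_\ell}(1,2)^T$. -}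

module Defs where

open import Data.Nat using (ℕ; zero; suc; _+_; _*_; _∸_; _<ᵇ_; _≡ᵇ_)
open import Data.Bool using (Bool; true; false; if_then_else_; _∧_)
open import Data.List using (List; []; _∷_; replicate; _++_; take; drop; length; map; upTo)
open import Data.Maybe using (Maybe; just; nothing; map)
open import Data.Product using (_×_; _,_)

data Bit : Set where
  b0 b1 : Bit

record Mat : Set where
  constructor mat
  field
    a b c d : ℕ

_⊗_ : Mat → Mat → Mat
mat a b c d ⊗ mat a' b' c' d' =
  mat (a * a' + b * c') (a * b' + b * d') (c * a' + d * c') (c * b' + d * d')

I₂ : Mat
I₂ = mat 1 0 0 1

Φ : Bit → Mat
Φ b0 = mat 0 1 1 1
Φ b1 = mat 1 0 1 1

Φprod : List Bit → Mat
Φprod []      = I₂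
Φprod (s ∷ σ) = Φ s ⊗ Φprod σ

apply12 : Mat → ℕ × ℕ
apply12 (mat a b c d) = (a + 2 * b , c + 2 * d)

-- Binary sequence of x = p/q (lowest terms, 0 < x < 1), computed by iterating the
-- Farey map F until the value 1/2 is reached:
--   x ∈ (1/2,1) (i.e. q < 2p < 2q): digit 0, F(p/q) = (q-p)/p
--   x ∈ (0,1/2) (i.e. 0 < p, 2p < q): digit 1, F(p/q) = p/(q-p)
-- The first argument is fuel (the denominator strictly decreases, so fuel q suffices);
-- 'nothing' signals that 1/2 was not reached (x not in (0,1) or out of fuel).
binSeqF : ℕ → ℕ → ℕ → Maybe (List Bit)
binSeqF fuel p q with (p ≡ᵇ 1) ∧ (q ≡ᵇ 2)
... | true = just []
binSeqF zero p q | false = nothing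
binSeqF (suc fuel) p q | false with (q <ᵇ 2 * p) ∧ (p <ᵇ q)
... | true = Data.Maybe.map (b0 ∷_) (binSeqF fuel (q ∸ p) p)
... | false with (0 <ᵇ p) ∧ (2 * p <ᵇ q)
... | true = Data.Maybe.map (b1 ∷_) (binSeqF fuel p (q ∸ p))
... | false = nothing

binSeq : ℕ → ℕ → Maybe (List Bit)
binSeq p q = binSeqF q p q

-- The partition (n₁^{k₁}, n₂^{k₂}) as the list of its parts; partitions are compared
-- up to permutation of parts (_↭_).
partitionAt : List Bit → ℕ → List ℕ
partitionAt σ m with Φprod (take m σ) | apply12 (Φprod (drop m σ))
... | mat h₂ h₁ k₂ k₁ | (n₂ , n₁) = replicate k₁ n₁ ++ replicate k₂ n₂

orbit : List Bit → List (List ℕ)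
orbit σ = Data.List.map (λ i → partitionAt σ (suc i)) (upTo (length σ))

-- For x ≠ 1/2 the numbers x and 1 − x lie on opposite sides of 1/2 and have the
-- same Farey image, F(x) = F(1 − x); so their binary sequences differ only in the
-- first digit. That digit is invisible in the orbit, because every partition is
-- read off the bottom row of a product Φ_{σ₁}⋯Φ_{σ_m} with m ≥ 1, and Φ₀, Φ₁ have
-- the same bottom row (1 1). Coprimality is used only to see that the Farey
-- iteration reaches 1/2.
module Submission where

open import Defs
open import Data.Bool using (true; false; _∧_; T)
open import Data.Bool.Properties using (T-≡; ∧-zeroʳ)
open import Data.Empty using (⊥-elim)
open import Data.List using (List; []; _∷_)
import Data.List.Relation.Binary.Pointwise as Pointwise
open Pointwise using (Pointwise)
open import Data.List.Relation.Binary.Permutation.Propositional using (_↭_; ↭-refl; ↭-sym)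
import Data.Maybe as Maybe
open Maybe using (just)
open import Data.Nat using (ℕ; zero; suc; _+_; _*_; _∸_; _≤_; _<_; _<ᵇ_; _≡ᵇ_; s≤s)
open import Data.Nat.Properties
open import Data.Nat.Coprimality using (Coprime; gcd≡1⇒coprime)
import Data.Nat.Coprimality as Coprime
open import Data.Nat.Divisibility using (∣-refl; ∣m∸n∣n⇒∣m)
open import Data.Nat.GCD using (gcd)
open import Data.Product using (Σ; ∃; _×_; _,_)
open import Function.Bundles using (Equivalence)
open import Relation.Binary.Definitions using (tri<; tri≈; tri>)
open import Relation.Binary.PropositionalEquality using (_≡_; refl; sym; trans; cong; subst)
open import Relation.Nullary using (¬_)

private
  variable
    f m n p p' q : ℕ

¬T⇒≡false : ∀ {b} → ¬ T b → b ≡ false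
¬T⇒≡false {false} _ = refl
¬T⇒≡false {true}  ¬t = ⊥-elim (¬t _)

<ᵇ-true : m < n → (m <ᵇ n) ≡ true
<ᵇ-true m<n = Equivalence.to T-≡ (<⇒<ᵇ m<n)

<ᵇ-false : n ≤ m → (m <ᵇ n) ≡ false
<ᵇ-false {n} {m} n≤m = ¬T⇒≡false (λ t → ≤⇒≯ n≤m (<ᵇ⇒< m n t))

≡ᵇ2-false : 2 < n → (n ≡ᵇ 2) ≡ false
≡ᵇ2-false {n} 2<n = ¬T⇒≡false (λ t → <⇒≢ 2<n (sym (≡ᵇ⇒≡ n 2 t)))

coprime-∸ : n ≤ m → Coprime m n → Coprime n (m ∸ n)
coprime-∸ n≤m cop (d∣n , d∣m∸n) = cop (∣m∸n∣n⇒∣m _ n≤m d∣m∸n d∣n , d∣n)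

coprime-diagonal : Coprime n n → n ≡ 1
coprime-diagonal cop = cop (∣-refl , ∣-refl)

2<m+n : 0 < m → m < n → 2 < m + n
2<m+n 0<m m<n = +-mono-≤ 0<m (≤-trans (s≤s 0<m) m<n)

2*m<m+n : m < n → 2 * m < m + n
2*m<m+n {m} m<n = +-monoʳ-< m (subst (_< _) (sym (+-identityʳ m)) m<n)

m+n<2*n : m < n → m + n < 2 * n
m+n<2*n {n = n} m<n = +-mono-<-≤ m<n (≤-reflexive (sym (+-identityʳ n)))

binSeqF-below-half : p + p' ≡ q → 0 < p → p < p' →
  binSeqF (suc f) p q ≡ Maybe.map (b1 ∷_) (binSeqF f p p')
binSeqF-below-half {p} {p'} refl 0<p p<p'
  rewrite ≡ᵇ2-false (2<m+n 0<p p<p') | ∧-zeroʳ (p ≡ᵇ 1)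
        | <ᵇ-false (<⇒≤ (2*m<m+n p<p')) | <ᵇ-true 0<p | <ᵇ-true (2*m<m+n p<p')
        | m+n∸m≡n p p' = refl

binSeqF-above-half : p + p' ≡ q → 0 < p → p < p' →
  binSeqF (suc f) p' q ≡ Maybe.map (b0 ∷_) (binSeqF f p p')
binSeqF-above-half {p} {p'} refl 0<p p<p'
  rewrite ≡ᵇ2-false (2<m+n 0<p p<p') | ∧-zeroʳ (p' ≡ᵇ 1)
        | <ᵇ-true (m+n<2*n p<p') | <ᵇ-true (m<n+m p' 0<p)
        | m+n∸n≡m p p' = refl

binSeqF-half : Coprime p p → p + p ≡ q → binSeqF f p q ≡ just []
binSeqF-half cop refl with coprime-diagonal cop
... | refl = refl

map-just : ∀ {A B : Set} {g : A → B} {x y} →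
  x ≡ Maybe.map g y → ∃ (λ σ → y ≡ just σ) → ∃ (λ τ → x ≡ just τ)
map-just {g = g} x≡gy (σ , y≡σ) = g σ , trans x≡gy (cong (Maybe.map g) y≡σ)

binSeqF-just : Coprime p q → 0 < p → p < q → q ≤ suc f →
  ∃ λ σ → binSeqF f p q ≡ just σ
binSeqF-just {p} {q} {zero} _ 0<p p<q q≤1 = ⊥-elim (<⇒≱ (≤-trans (s≤s 0<p) p<q) q≤1)
binSeqF-just {p} {q} {suc f} cop 0<p p<q q≤2+f with <-cmp p (q ∸ p)
... | tri< p<d _ _ = map-just (binSeqF-below-half (m+[n∸m]≡n p≤q) 0<p p<d)
  (binSeqF-just (coprime-∸ p≤q (Coprime.sym cop)) 0<p p<d d≤1+f)
  where
  p≤q = <⇒≤ p<q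
  d≤1+f = <⇒≤pred (≤-trans (∸-monoʳ-< 0<p p≤q) q≤2+f)
... | tri> _ _ d<p = map-just (binSeqF-above-half (trans (+-comm _ p) (m+[n∸m]≡n p≤q)) 0<d d<p)
  (binSeqF-just (Coprime.sym (coprime-∸ p≤q (Coprime.sym cop))) 0<d d<p p≤1+f)
  where
  p≤q = <⇒≤ p<q
  0<d = m<n⇒0<n∸m p<q
  p≤1+f = <⇒≤pred (≤-trans p<q q≤2+f)
... | tri≈ _ p≡d _ = [] , binSeqF-half cop-p-p p+p≡q
  where
  p≤q = <⇒≤ p<q
  cop-p-p = subst (Coprime p) (sym p≡d) (coprime-∸ p≤q (Coprime.sym cop))
  p+p≡q = subst (λ d → p + d ≡ q) (sym p≡d) (m+[n∸m]≡n p≤q)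

orbit-b1∷≡orbit-b0∷ : ∀ ρ → orbit (b1 ∷ ρ) ≡ orbit (b0 ∷ ρ)
orbit-b1∷≡orbit-b0∷ ρ = refl

SameOrbit : ℕ → ℕ → ℕ → Set
SameOrbit p p' q = Σ (List Bit) λ σ → Σ (List Bit) λ τ →
  (binSeq p q ≡ just σ) × (binSeq p' q ≡ just τ) × Pointwise _↭_ (orbit σ) (orbit τ)

sameOrbit-sym : SameOrbit p p' q → SameOrbit p' p q
sameOrbit-sym (σ , τ , eqσ , eqτ , σ∼τ) = τ , σ , eqτ , eqσ , Pointwise.symmetric ↭-sym σ∼τ

sameOrbit-complement-< : 0 < p → p < p' → Coprime p p' → SameOrbit p p' (p + p')
sameOrbit-complement-< {suc p₀} {p'} 0<p p<p' cop
  with ρ , eq ← binSeqF-just {f = p₀ + p'} cop 0<p p<p' (m≤n+m p' (suc p₀))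
  = b1 ∷ ρ , b0 ∷ ρ
  , trans (binSeqF-below-half refl 0<p p<p') (cong (Maybe.map (b1 ∷_)) eq)
  , trans (binSeqF-above-half refl 0<p p<p') (cong (Maybe.map (b0 ∷_)) eq)
  , subst (Pointwise _↭_ (orbit (b1 ∷ ρ))) (orbit-b1∷≡orbit-b0∷ ρ) (Pointwise.refl ↭-refl)

sameOrbit-complement : 0 < p → 0 < p' → Coprime p p' → SameOrbit p p' (p + p')
sameOrbit-complement {p} {p'} 0<p 0<p' cop with <-cmp p p'
... | tri< p<p' _ _ = sameOrbit-complement-< 0<p p<p' cop
... | tri> _ _ p'<p = sameOrbit-sym {p'} {p}
  (subst (SameOrbit p' p) (+-comm p' p) (sameOrbit-complement-< 0<p' p'<p (Coprime.sym cop)))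
... | tri≈ _ refl _ with coprime-diagonal cop
...   | refl = [] , [] , refl , refl , Pointwise.[]

lemma4p3 : (n r : ℕ) → 2 ≤ n → 1 ≤ r → r < n → gcd r n ≡ 1 →
    Σ (List Bit) λ σ → Σ (List Bit) λ τ →
    (binSeq r n ≡ just σ) × (binSeq (n ∸ r) n ≡ just τ) ×
    Pointwise _↭_ (orbit σ) (orbit τ)
lemma4p3 n r _ 0<r r<n gcd≡1 =
  subst (SameOrbit r (n ∸ r)) (m+[n∸m]≡n r≤n)
    (sameOrbit-complement 0<r (m<n⇒0<n∸m r<n) (coprime-∸ r≤n (Coprime.sym (gcd≡1⇒coprime gcd≡1))))
  where
  r≤n = <⇒≤ r<n
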